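{- Let $a\in\mathbb{R}$, $d,n\in\mathbb{N}$, $\bm s=(s_1,\dots,s_d)\in\mathbb{N}^d$, $|\bm s|_r:=\sum_{i=1}^r s_i$ ($|\bm s|_0=0$), $|\bm s|:=|\bm s|_d$, and for indices $n_1,n_2,\dots$ define $Q(\bm s):=\sum_{r=1}^d\bigl(n_{|\bm s|_{r-1}+1}-n_{|\bm s|_r}\bigr)$. Then \[ \frac1{n+1}\sum_{k=1}^n\zeta_k^\star(\bm s;a)=\sum_{n\ge n_1\ge\cdots\ge n_{|\bm s|+1}\ge1}\frac{\binom{n_{|\bm s|}}{n_{|\bm s|+1}}}{\binom{Q(\bm s)+n_{|\bm s|}}{n_{|\bm s|+1}}}\cdot\frac{a^{n_{|\bm s|+1}}}{(Q(\bm s)+n_{|\bm s|}+1)\,n_1\cdots n_{|\bm s|}}. \]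
   Context: $\zeta_k^\star(s_1,\dots,s_d;a):=\sum_{k\ge m_1\ge\cdots\ge m_d\ge 1}\frac{a^{m_d}}{m_1^{s_1}\cdots m_d^{s_d}}$. In the right-hand side, $Q(\bm s)$ is evaluated at the summation indices $n_1,\dots,n_{|\bm s|}$.
   Formalization: The parameter a ranges over the rationals instead of the reals. -}

module Defs where

open import Data.Nat as ℕ using (ℕ; zero; suc; _∸_)
open import Data.Nat.Combinatorics using (_C_)
open import Data.Integer using (+_)
open import Data.Rational using (ℚ; 0ℚ; 1ℚ; _/_) renaming (_+_ to _+q_; _*_ to _*q_)
open import Data.List using (List; []; _∷_; _++_)
open import Data.Vec using (Vec; []; _∷_)

_^q_ : ℚ → ℕ → ℚ
a ^q zero = 1ℚ
a ^q suc m = a *q (a ^q m)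

-- n / d as a rational for naturals; d is always positive where used
-- (the value 0 for d = 0 is a junk default never reached)
frac : ℕ → ℕ → ℚ
frac n zero = 0ℚ
frac n (suc d) = (+ n) / suc d

sumFrom1 : ℕ → (ℕ → ℚ) → ℚ
sumFrom1 zero f = 0ℚ
sumFrom1 (suc n) f = sumFrom1 n f +q f (suc n)

-- sum over chains  u ≥ m₁ ≥ m₂ ≥ ⋯ ≥ m_len ≥ 1  of f (m₁ ∷ ⋯ ∷ m_len ∷ [])
chainSum : (len u : ℕ) → (List ℕ → ℚ) → ℚ
chainSum zero u f = f []
chainSum (suc len) u f = sumFrom1 u (λ m → chainSum len m (λ ms → f (m ∷ ms)))

-- 1-based indexing n_i of a list of indices (default 0 out of range; never used)
idx : List ℕ → ℕ → ℕ
idx [] i = 0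
idx (x ∷ xs) zero = 0
idx (x ∷ xs) (suc zero) = x
idx (x ∷ xs) (suc (suc i)) = idx xs (suc i)

lastL : List ℕ → ℕ
lastL [] = 0
lastL (x ∷ []) = x
lastL (x ∷ y ∷ xs) = lastL (y ∷ xs)

prodPow : ∀ {d} → Vec ℕ d → List ℕ → ℕ
prodPow [] ms = 1
prodPow (s ∷ ss) [] = 1
prodPow (s ∷ ss) (m ∷ ms) = (m ℕ.^ s) ℕ.* prodPow ss ms

prodFirst : ℕ → List ℕ → ℕ
prodFirst zero ms = 1
prodFirst (suc N) [] = 1
prodFirst (suc N) (m ∷ ms) = m ℕ.* prodFirst N ms

zetaStar : ∀ {d} → ℕ → Vec ℕ d → ℚ → ℚ
zetaStar {d} k s a = chainSum d k (λ ms → (a ^q lastL ms) *q frac 1 (prodPow s ms))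

partialWt : ∀ {d} → Vec ℕ d → ℕ → ℕ
partialWt [] r = 0
partialWt (x ∷ s) zero = 0
partialWt (x ∷ s) (suc r) = x ℕ.+ partialWt s r

wt : ∀ {d} → Vec ℕ d → ℕ
wt {d} s = partialWt s d

-- Q(s) = Σ_{r=1}^{d} (n_{|s|_{r-1}+1} - n_{|s|_r}), evaluated at the indices ns
-- (each summand is ≥ 0 on decreasing chains with s_i ≥ 1, so ∸ is exact)
Qs : ∀ {d} → Vec ℕ d → List ℕ → ℕ
Qs {d} s ns = go d
  where
  go : ℕ → ℕ
  go zero = 0
  go (suc r) = go r ℕ.+ (idx ns (suc (partialWt s r)) ∸ idx ns (partialWt s (suc r)))

lhs6 : ∀ {d} → ℕ → Vec ℕ d → ℚ → ℚ
lhs6 n s a = frac 1 (suc n) *q sumFrom1 n (λ k → zetaStar k s a)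

rhsTerm6 : ∀ {d} → Vec ℕ d → ℚ → List ℕ → ℚ
rhsTerm6 s a ns =
  frac (nN C nN1) ((Q ℕ.+ nN) C nN1)
    *q ((a ^q nN1) *q frac 1 ((Q ℕ.+ nN ℕ.+ 1) ℕ.* prodFirst N ns))
  where
  N = wt s
  nN = idx ns N
  nN1 = idx ns (suc N)
  Q = Qs s ns

rhs6 : ∀ {d} → ℕ → Vec ℕ d → ℚ → ℚ
rhs6 n s a = chainSum (suc (wt s)) n (rhsTerm6 s a)

{-# OPTIONS --safe #-}
-- Write K_P(x, k) = C(x, k) / (C(P, k) (P + 1)) (`kernel`). Since K_n(n, k) = 1/(n + 1),
-- the left-hand side is Σ_{k ≤ n} K_n(n, k) ζ*_k(s; a). Two identities trade the factor 1/m
-- of an inner summation index m for a new outer index: for fixed P,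
--   K_P(z, m) / m = Σ_{w ≤ z} K_P(w, m) / w                      (a hockey-stick sum),
-- and, when P grows with x,
--   (1/m) Σ_{k = m}^{x} K_{D+x}(x, k) = Σ_{y = m}^{x} K_{D+y}(y, m) / y,
-- whose left side has a closed form by trinomial revision that telescopes in x.
-- Used s₁ times they peel the first block n₁ ≥ ⋯ ≥ n_{s₁} off ζ* and leave
-- Σ_k K_{D′+l}(l, k) ζ*_k(s₂, …; a) with l = n_{s₁} and D′ = D + n₁ − n_{s₁}, so induction on
-- the depth, with the shift D accumulating Q(s), produces the right-hand side.
module Submission where

open import Defs
open import Data.Nat as ℕ using (ℕ; zero; suc; _≤_; _<_; z≤n; s≤s; _∸_; NonZero)
import Data.Nat.Properties as ℕ
open import Data.Nat.Combinatorics using (_C_; nCk+nC[k+1]≡[n+1]C[k+1]; k>n⇒nCk≡0; nC1≡n)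
open import Data.Nat.ListAction using (product)
open import Data.Nat.Solver renaming (module +-*-Solver to ℕ-Solver)
open import Algebra.Properties.CommutativeSemigroup ℕ.*-commutativeSemigroup using (x∙yz≈y∙xz)
import Data.Integer as ℤ
import Data.Integer.Properties as ℤ
open import Data.Rational as ℚ using (ℚ; 0ℚ; _+_; _*_; _-_)
import Data.Rational.Properties as ℚ
open import Data.Rational.Solver renaming (module +-*-Solver to ℚ-Solver)
import Data.Rational.Unnormalised as ℚᵘ
import Data.Rational.Unnormalised.Properties as ℚᵘ
import Data.Fin as Fin
open import Data.List using (List; []; _∷_; _++_; length)
open import Data.Vec using (Vec; []; _∷_; lookup)
open import Data.Product using (_,_)
open import Data.Sum using (inj₁; inj₂)
open import Relation.Binary.PropositionalEquality

fromℚᵘ-homo-* : ∀ p q → ℚ.fromℚᵘ (p ℚᵘ.* q) ≡ ℚ.fromℚᵘ p * ℚ.fromℚᵘ q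
fromℚᵘ-homo-* p q = ℚ.toℚᵘ-injective (ℚᵘ.≃-trans (ℚ.toℚᵘ-fromℚᵘ (p ℚᵘ.* q))
  (ℚᵘ.≃-sym (ℚᵘ.≃-trans (ℚ.toℚᵘ-homo-* (ℚ.fromℚᵘ p) (ℚ.fromℚᵘ q))
    (ℚᵘ.*-cong (ℚ.toℚᵘ-fromℚᵘ p) (ℚ.toℚᵘ-fromℚᵘ q)))))

fromℚᵘ-homo-+ : ∀ p q → ℚ.fromℚᵘ (p ℚᵘ.+ q) ≡ ℚ.fromℚᵘ p + ℚ.fromℚᵘ q
fromℚᵘ-homo-+ p q = ℚ.toℚᵘ-injective (ℚᵘ.≃-trans (ℚ.toℚᵘ-fromℚᵘ (p ℚᵘ.+ q))
  (ℚᵘ.≃-sym (ℚᵘ.≃-trans (ℚ.toℚᵘ-homo-+ (ℚ.fromℚᵘ p) (ℚ.fromℚᵘ q))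
    (ℚᵘ.+-cong (ℚ.toℚᵘ-fromℚᵘ p) (ℚ.toℚᵘ-fromℚᵘ q)))))

frac-cross : ∀ a b c d .{{_ : NonZero b}} .{{_ : NonZero d}} →
             a ℕ.* d ≡ c ℕ.* b → frac a b ≡ frac c d
frac-cross a (suc b) c (suc d) eq = ℚ.fromℚᵘ-cong {ℚᵘ.mkℚᵘ (ℤ.+ a) b} {ℚᵘ.mkℚᵘ (ℤ.+ c) d}
  (ℚᵘ.*≡* (trans (sym (ℤ.pos-* a (suc d))) (trans (cong ℤ.+_ eq) (ℤ.pos-* c (suc b)))))

frac-* : ∀ a b c d → frac a b * frac c d ≡ frac (a ℕ.* c) (b ℕ.* d)
frac-* a zero c d = ℚ.*-zeroˡ (frac c d)
frac-* a (suc b) c zero = trans (ℚ.*-zeroʳ (frac a (suc b))) (cong (frac (a ℕ.* c)) (sym (ℕ.*-zeroʳ (suc b))))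
frac-* a (suc b) c (suc d) = trans (sym (fromℚᵘ-homo-* (ℚᵘ.mkℚᵘ (ℤ.+ a) b) (ℚᵘ.mkℚᵘ (ℤ.+ c) d)))
  (cong (λ n → ℚ.fromℚᵘ (ℚᵘ.mkℚᵘ n (d ℕ.+ b ℕ.* suc d))) (sym (ℤ.pos-* a c)))

frac-*-swap : ∀ a b c d → frac a b * frac c d ≡ frac c b * frac a d
frac-*-swap a b c d =
  trans (frac-* a b c d) (trans (cong (λ n → frac n (b ℕ.* d)) (ℕ.*-comm a c)) (sym (frac-* c b a d)))

frac-+ : ∀ a c b → frac a b + frac c b ≡ frac (a ℕ.+ c) b
frac-+ a c zero = ℚ.+-identityˡ 0ℚ
frac-+ a c (suc b) = trans (sym (fromℚᵘ-homo-+ (ℚᵘ.mkℚᵘ (ℤ.+ a) b) (ℚᵘ.mkℚᵘ (ℤ.+ c) b)))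
  (trans (cong (λ n → ℚ.fromℚᵘ (ℚᵘ.mkℚᵘ n (b ℕ.+ b ℕ.* suc b)))
           (trans (cong₂ ℤ._+_ (sym (ℤ.pos-* a (suc b))) (sym (ℤ.pos-* c (suc b))))
                  (sym (ℤ.pos-+ (a ℕ.* suc b) (c ℕ.* suc b)))))
         (frac-cross (a ℕ.* suc b ℕ.+ c ℕ.* suc b) (suc b ℕ.* suc b) (a ℕ.+ c) (suc b)
                     (solve 3 (λ a c b → (a :* b :+ c :* b) :* b := (a :+ c) :* (b :* b)) refl a c (suc b))))
  where open ℕ-Solver

frac-0 : ∀ b → frac 0 b ≡ 0ℚ
frac-0 zero = refl
frac-0 (suc b) = frac-cross 0 (suc b) 0 1 refl

frac-1-distrib-* : ∀ b d → frac 1 (b ℕ.* d) ≡ frac 1 b * frac 1 d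
frac-1-distrib-* b d = sym (frac-* 1 b 1 d)

sumFrom1-cong : ∀ n {f g : ℕ → ℚ} → (∀ k → 1 ≤ k → k ≤ n → f k ≡ g k) →
                sumFrom1 n f ≡ sumFrom1 n g
sumFrom1-cong zero eq = refl
sumFrom1-cong (suc n) eq =
  cong₂ _+_ (sumFrom1-cong n (λ k 1≤k k≤n → eq k 1≤k (ℕ.m≤n⇒m≤1+n k≤n)))
            (eq (suc n) (s≤s z≤n) ℕ.≤-refl)

sumFrom1-ext : ∀ n {f g : ℕ → ℚ} → (∀ k → f k ≡ g k) → sumFrom1 n f ≡ sumFrom1 n g
sumFrom1-ext n eq = sumFrom1-cong n (λ k _ _ → eq k)

sumFrom1-zero : ∀ n → sumFrom1 n (λ _ → 0ℚ) ≡ 0ℚ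
sumFrom1-zero zero = refl
sumFrom1-zero (suc n) = trans (ℚ.+-identityʳ _) (sumFrom1-zero n)

sumFrom1-distrib-+ : ∀ n (f g : ℕ → ℚ) → sumFrom1 n (λ k → f k + g k) ≡ sumFrom1 n f + sumFrom1 n g
sumFrom1-distrib-+ zero f g = sym (ℚ.+-identityʳ 0ℚ)
sumFrom1-distrib-+ (suc n) f g =
  trans (cong (_+ (f (suc n) + g (suc n))) (sumFrom1-distrib-+ n f g))
        (solve 4 (λ a b c d → (a :+ b) :+ (c :+ d) := (a :+ c) :+ (b :+ d)) refl
               (sumFrom1 n f) (sumFrom1 n g) (f (suc n)) (g (suc n)))
  where open ℚ-Solver

*-distribˡ-sumFrom1 : ∀ n c (f : ℕ → ℚ) → c * sumFrom1 n f ≡ sumFrom1 n (λ k → c * f k)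
*-distribˡ-sumFrom1 zero c f = ℚ.*-zeroʳ c
*-distribˡ-sumFrom1 (suc n) c f =
  trans (ℚ.*-distribˡ-+ c (sumFrom1 n f) (f (suc n))) (cong (_+ c * f (suc n)) (*-distribˡ-sumFrom1 n c f))

*-distribʳ-sumFrom1 : ∀ n c (f : ℕ → ℚ) → sumFrom1 n f * c ≡ sumFrom1 n (λ k → f k * c)
*-distribʳ-sumFrom1 zero c f = ℚ.*-zeroˡ c
*-distribʳ-sumFrom1 (suc n) c f =
  trans (ℚ.*-distribʳ-+ c (sumFrom1 n f) (f (suc n))) (cong (_+ f (suc n) * c) (*-distribʳ-sumFrom1 n c f))

sumFrom1-comm : ∀ n m (h : ℕ → ℕ → ℚ) →
                sumFrom1 n (λ i → sumFrom1 m (h i)) ≡ sumFrom1 m (λ j → sumFrom1 n (λ i → h i j))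
sumFrom1-comm zero m h = sym (sumFrom1-zero m)
sumFrom1-comm (suc n) m h =
  trans (cong (_+ sumFrom1 m (h (suc n))) (sumFrom1-comm n m h))
        (sym (sumFrom1-distrib-+ m (λ j → sumFrom1 n (λ i → h i j)) (h (suc n))))

sumFrom1-vanishing : ∀ {w} z (f : ℕ → ℚ) → w ≤ z → (∀ k → w < k → k ≤ z → f k ≡ 0ℚ) →
                     sumFrom1 z f ≡ sumFrom1 w f
sumFrom1-vanishing zero f z≤n _ = refl
sumFrom1-vanishing (suc z) f w≤1+z f≡0 with ℕ.m≤n⇒m<n∨m≡n w≤1+z
... | inj₂ refl = refl
... | inj₁ (s≤s w≤z) =
  trans (cong₂ _+_ (sumFrom1-vanishing z f w≤z (λ k w<k k≤z → f≡0 k w<k (ℕ.m≤n⇒m≤1+n k≤z)))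
                   (f≡0 (suc z) (s≤s w≤z) ℕ.≤-refl))
        (ℚ.+-identityʳ _)

sumFrom1-triangle : ∀ x (h : ℕ → ℕ → ℚ) →
  sumFrom1 x (λ k → sumFrom1 k (h k)) ≡
  sumFrom1 x (λ m → sumFrom1 x (λ k → h k m) - sumFrom1 (ℕ.pred m) (λ k → h k m))
sumFrom1-triangle zero h = refl
sumFrom1-triangle (suc x) h = begin
  sumFrom1 x (λ k → sumFrom1 k (h k)) + sumFrom1 (suc x) (h (suc x))
    ≡⟨ cong (_+ sumFrom1 (suc x) (h (suc x))) (sumFrom1-triangle x h) ⟩
  sumFrom1 x (λ m → col x m - row m) + (sumFrom1 x (h (suc x)) + h (suc x) (suc x))
    ≡⟨ regroup (sumFrom1 x (λ m → col x m - row m)) (sumFrom1 x (h (suc x)))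
               (col x (suc x)) (h (suc x) (suc x)) ⟩
  (sumFrom1 x (λ m → col x m - row m) + sumFrom1 x (h (suc x))) + (col (suc x) (suc x) - row (suc x))
    ≡⟨ cong (_+ (col (suc x) (suc x) - row (suc x)))
            (sym (sumFrom1-distrib-+ x (λ m → col x m - row m) (h (suc x)))) ⟩
  sumFrom1 x (λ m → (col x m - row m) + h (suc x) m) + (col (suc x) (suc x) - row (suc x))
    ≡⟨ cong (_+ (col (suc x) (suc x) - row (suc x)))
            (sumFrom1-ext x (λ m → swap-sub (col x m) (row m) (h (suc x) m))) ⟩
  sumFrom1 x (λ m → col (suc x) m - row m) + (col (suc x) (suc x) - row (suc x)) ∎
  where
  open ≡-Reasoning
  open ℚ-Solver
  col : ℕ → ℕ → ℚ
  col n m = sumFrom1 n (λ k → h k m)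
  row : ℕ → ℚ
  row m = sumFrom1 (ℕ.pred m) (λ k → h k m)
  regroup : ∀ a b c d → a + (b + d) ≡ (a + b) + ((c + d) - c)
  regroup = solve 4 (λ a b c d → a :+ (b :+ d) := (a :+ b) :+ ((c :+ d) :- c)) refl
  swap-sub : ∀ a b c → (a - b) + c ≡ (a + c) - b
  swap-sub = solve 3 (λ a b c → (a :- b) :+ c := (a :+ c) :- b) refl

data Chain : ℕ → ℕ → List ℕ → Set where
  []  : ∀ {u} → Chain 0 u []
  _∷_ : ∀ {len u m ms} → m ≤ u → Chain len m ms → Chain (suc len) u (m ∷ ms)

Chain-length : ∀ {len u ms} → Chain len u ms → length ms ≡ len
Chain-length []      = refl
Chain-length (_ ∷ c) = cong suc (Chain-length c)

lastOr : ℕ → List ℕ → ℕ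
lastOr u []       = u
lastOr u (m ∷ ms) = lastOr m ms

Chain-lastOr≤ : ∀ {len u ms} → Chain len u ms → lastOr u ms ≤ u
Chain-lastOr≤ []        = ℕ.≤-refl
Chain-lastOr≤ (m≤u ∷ c) = ℕ.≤-trans (Chain-lastOr≤ c) m≤u

chainSum-cong : ∀ len u {f g : List ℕ → ℚ} → (∀ ms → Chain len u ms → f ms ≡ g ms) →
                chainSum len u f ≡ chainSum len u g
chainSum-cong zero u eq = eq [] []
chainSum-cong (suc len) u eq =
  sumFrom1-cong u (λ m _ m≤u → chainSum-cong len m (λ ms c → eq (m ∷ ms) (m≤u ∷ c)))

*-distribˡ-chainSum : ∀ len u c (f : List ℕ → ℚ) → c * chainSum len u f ≡ chainSum len u (λ ms → c * f ms)
*-distribˡ-chainSum zero u c f = refl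
*-distribˡ-chainSum (suc len) u c f =
  trans (*-distribˡ-sumFrom1 u c _) (sumFrom1-ext u (λ m → *-distribˡ-chainSum len m c (λ ms → f (m ∷ ms))))

chainSum-++ : ∀ len₁ len₂ u (f : List ℕ → ℚ) →
  chainSum (len₁ ℕ.+ len₂) u f ≡
  chainSum len₁ u (λ pre → chainSum len₂ (lastOr u pre) (λ rest → f (pre ++ rest)))
chainSum-++ zero len₂ u f = refl
chainSum-++ (suc len₁) len₂ u f = sumFrom1-ext u (λ m → chainSum-++ len₁ len₂ m (λ ms → f (m ∷ ms)))

nCk≢0 : ∀ {n k} → k ≤ n → NonZero (n C k)
nCk≢0 {n} {zero} _ = _
nCk≢0 {suc n} {suc k} (s≤s k≤n) rewrite sym (nCk+nC[k+1]≡[n+1]C[k+1] n k) =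
  ℕ.>-nonZero (ℕ.≤-trans (ℕ.>-nonZero⁻¹ (n C k) {{nCk≢0 k≤n}}) (ℕ.m≤m+n (n C k) (n C suc k)))

[k+1]*[n+1]C[k+1]≡[n+1]*nCk : ∀ n k → suc k ℕ.* (suc n C suc k) ≡ suc n ℕ.* (n C k)
[k+1]*[n+1]C[k+1]≡[n+1]*nCk zero zero = refl
[k+1]*[n+1]C[k+1]≡[n+1]*nCk zero (suc k) = ℕ.*-zeroʳ (suc (suc k))
[k+1]*[n+1]C[k+1]≡[n+1]*nCk (suc n) zero =
  trans (ℕ.*-identityˡ _) (trans (nC1≡n (suc (suc n))) (sym (ℕ.*-identityʳ (suc (suc n)))))
[k+1]*[n+1]C[k+1]≡[n+1]*nCk (suc n) (suc k) = begin
  suc (suc k) ℕ.* (suc (suc n) C suc (suc k))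
    ≡⟨ cong (suc (suc k) ℕ.*_) (sym (nCk+nC[k+1]≡[n+1]C[k+1] (suc n) (suc k))) ⟩
  suc (suc k) ℕ.* (suc n C suc k ℕ.+ suc n C suc (suc k))
    ≡⟨ ℕ.*-distribˡ-+ (suc (suc k)) (suc n C suc k) (suc n C suc (suc k)) ⟩
  suc n C suc k ℕ.+ suc k ℕ.* (suc n C suc k) ℕ.+ suc (suc k) ℕ.* (suc n C suc (suc k))
    ≡⟨ cong₂ (λ a b → suc n C suc k ℕ.+ a ℕ.+ b)
             ([k+1]*[n+1]C[k+1]≡[n+1]*nCk n k) ([k+1]*[n+1]C[k+1]≡[n+1]*nCk n (suc k)) ⟩
  suc n C suc k ℕ.+ suc n ℕ.* (n C k) ℕ.+ suc n ℕ.* (n C suc k)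
    ≡⟨ ℕ.+-assoc (suc n C suc k) _ _ ⟩
  suc n C suc k ℕ.+ (suc n ℕ.* (n C k) ℕ.+ suc n ℕ.* (n C suc k))
    ≡⟨ cong (suc n C suc k ℕ.+_) (sym (ℕ.*-distribˡ-+ (suc n) (n C k) (n C suc k))) ⟩
  suc n C suc k ℕ.+ suc n ℕ.* (n C k ℕ.+ n C suc k)
    ≡⟨ cong (λ c → suc n C suc k ℕ.+ suc n ℕ.* c) (nCk+nC[k+1]≡[n+1]C[k+1] n k) ⟩
  suc (suc n) ℕ.* (suc n C suc k) ∎
  where open ≡-Reasoning

[k+1]*[k+u]C[k+1]≡u*[k+u]Ck : ∀ k u → suc k ℕ.* ((k ℕ.+ u) C suc k) ≡ u ℕ.* ((k ℕ.+ u) C k)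
[k+1]*[k+u]C[k+1]≡u*[k+u]Ck k u = ℕ.+-cancelˡ-≡ (suc k ℕ.* c₀) _ _ (begin
  suc k ℕ.* c₀ ℕ.+ suc k ℕ.* c₁ ≡⟨ ℕ.*-distribˡ-+ (suc k) c₀ c₁ ⟨
  suc k ℕ.* (c₀ ℕ.+ c₁)         ≡⟨ cong (suc k ℕ.*_) (nCk+nC[k+1]≡[n+1]C[k+1] (k ℕ.+ u) k) ⟩
  suc k ℕ.* (suc (k ℕ.+ u) C suc k) ≡⟨ [k+1]*[n+1]C[k+1]≡[n+1]*nCk (k ℕ.+ u) k ⟩
  suc (k ℕ.+ u) ℕ.* c₀          ≡⟨ ℕ.*-distribʳ-+ c₀ (suc k) u ⟩
  suc k ℕ.* c₀ ℕ.+ u ℕ.* c₀     ∎)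
  where
  open ≡-Reasoning
  c₀ = (k ℕ.+ u) C k
  c₁ = (k ℕ.+ u) C suc k

[k+v+1]Ck*[v+1]≡[k+v+1]*[k+v]Ck : ∀ k v →
  (suc (k ℕ.+ v) C k) ℕ.* suc v ≡ suc (k ℕ.+ v) ℕ.* ((k ℕ.+ v) C k)
[k+v+1]Ck*[v+1]≡[k+v+1]*[k+v]Ck k v = begin
  (suc (k ℕ.+ v) C k) ℕ.* suc v       ≡⟨ ℕ.*-comm (suc (k ℕ.+ v) C k) (suc v) ⟩
  suc v ℕ.* (suc (k ℕ.+ v) C k)     ≡⟨ cong (λ n → suc v ℕ.* (n C k)) (ℕ.+-suc k v) ⟨
  suc v ℕ.* ((k ℕ.+ suc v) C k)     ≡⟨ [k+1]*[k+u]C[k+1]≡u*[k+u]Ck k (suc v) ⟨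
  suc k ℕ.* ((k ℕ.+ suc v) C suc k) ≡⟨ cong (λ n → suc k ℕ.* (n C suc k)) (ℕ.+-suc k v) ⟩
  suc k ℕ.* (suc (k ℕ.+ v) C suc k) ≡⟨ [k+1]*[n+1]C[k+1]≡[n+1]*nCk (k ℕ.+ v) k ⟩
  suc (k ℕ.+ v) ℕ.* ((k ℕ.+ v) C k) ∎
  where open ≡-Reasoning

trinomial-revision : ∀ D k w →
  ((k ℕ.+ w) C k) ℕ.* ((D ℕ.+ (k ℕ.+ w)) C D) ≡ ((D ℕ.+ w) C D) ℕ.* ((D ℕ.+ (k ℕ.+ w)) C k)
trinomial-revision D zero w = ℕ.*-comm 1 ((D ℕ.+ w) C D)
trinomial-revision D (suc k) w rewrite ℕ.+-suc D (k ℕ.+ w) =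
  ℕ.*-cancelˡ-≡ ((suc n C suc k) ℕ.* (suc N C D)) (((D ℕ.+ w) C D) ℕ.* (suc N C suc k)) (suc k) (begin
  suc k ℕ.* ((suc n C suc k) ℕ.* (suc N C D))
    ≡⟨ ℕ.*-assoc (suc k) (suc n C suc k) (suc N C D) ⟨
  suc k ℕ.* (suc n C suc k) ℕ.* (suc N C D)
    ≡⟨ cong (ℕ._* (suc N C D)) ([k+1]*[n+1]C[k+1]≡[n+1]*nCk n k) ⟩
  suc n ℕ.* (n C k) ℕ.* (suc N C D)
    ≡⟨ solve 3 (λ a b c → a :* b :* c := b :* (c :* a)) refl (suc n) (n C k) (suc N C D) ⟩
  (n C k) ℕ.* ((suc N C D) ℕ.* suc n)
    ≡⟨ cong ((n C k) ℕ.*_) ([k+v+1]Ck*[v+1]≡[k+v+1]*[k+v]Ck D n) ⟩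
  (n C k) ℕ.* (suc N ℕ.* (N C D))
    ≡⟨ solve 3 (λ a b c → a :* (b :* c) := b :* (a :* c)) refl (n C k) (suc N) (N C D) ⟩
  suc N ℕ.* ((n C k) ℕ.* (N C D))
    ≡⟨ cong (suc N ℕ.*_) (trinomial-revision D k w) ⟩
  suc N ℕ.* (((D ℕ.+ w) C D) ℕ.* (N C k))
    ≡⟨ solve 3 (λ a b c → a :* (b :* c) := b :* (a :* c)) refl (suc N) ((D ℕ.+ w) C D) (N C k) ⟩
  ((D ℕ.+ w) C D) ℕ.* (suc N ℕ.* (N C k))
    ≡⟨ cong (((D ℕ.+ w) C D) ℕ.*_) ([k+1]*[n+1]C[k+1]≡[n+1]*nCk N k) ⟨
  ((D ℕ.+ w) C D) ℕ.* (suc k ℕ.* (suc N C suc k))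
    ≡⟨ solve 3 (λ a b c → a :* (b :* c) := b :* (a :* c)) refl ((D ℕ.+ w) C D) (suc k) (suc N C suc k) ⟩
  suc k ℕ.* (((D ℕ.+ w) C D) ℕ.* (suc N C suc k)) ∎)
  where
  open ≡-Reasoning
  open ℕ-Solver
  n = k ℕ.+ w
  N = D ℕ.+ n

kernel : ℕ → ℕ → ℕ → ℚ
kernel P x k = frac (x C k) ((P C k) ℕ.* suc P)

kernelDenominator≢0 : ∀ {P k} → k ≤ P → NonZero ((P C k) ℕ.* suc P)
kernelDenominator≢0 {P} {k} k≤P = ℕ.m*n≢0 (P C k) (suc P) {{nCk≢0 k≤P}}

kernel-vanishes : ∀ P {x k} → x < k → kernel P x k ≡ 0ℚ
kernel-vanishes P {x} {k} x<k =
  trans (cong (λ n → frac n ((P C k) ℕ.* suc P)) (k>n⇒nCk≡0 x<k)) (frac-0 ((P C k) ℕ.* suc P))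

kernel-diagonal : ∀ {n k} → k ≤ n → kernel n n k ≡ frac 1 (suc n)
kernel-diagonal {n} {k} k≤n =
  frac-cross (n C k) ((n C k) ℕ.* suc n) 1 (suc n) (sym (ℕ.*-identityˡ ((n C k) ℕ.* suc n)))
  where instance _ = kernelDenominator≢0 k≤n

sumFrom1-wC[k+1]/w≡zC[k+1]/[k+1] : ∀ z k → sumFrom1 z (λ w → frac (w C suc k) w) ≡ frac (z C suc k) (suc k)
sumFrom1-wC[k+1]/w≡zC[k+1]/[k+1] zero k = sym (frac-0 (suc k))
sumFrom1-wC[k+1]/w≡zC[k+1]/[k+1] (suc z) k = begin
  sumFrom1 z (λ w → frac (w C suc k) w) + frac (suc z C suc k) (suc z)
    ≡⟨ cong₂ _+_ (sumFrom1-wC[k+1]/w≡zC[k+1]/[k+1] z k) (frac-cross (suc z C suc k) (suc z) (z C k) (suc k)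
                   (trans (ℕ.*-comm (suc z C suc k) (suc k))
                          (trans ([k+1]*[n+1]C[k+1]≡[n+1]*nCk z k) (ℕ.*-comm (suc z) (z C k))))) ⟩
  frac (z C suc k) (suc k) + frac (z C k) (suc k)
    ≡⟨ frac-+ (z C suc k) (z C k) (suc k) ⟩
  frac (z C suc k ℕ.+ z C k) (suc k)
    ≡⟨ cong (λ n → frac n (suc k)) (trans (ℕ.+-comm (z C suc k) (z C k)) (nCk+nC[k+1]≡[n+1]C[k+1] z k)) ⟩
  frac (suc z C suc k) (suc k) ∎
  where open ≡-Reasoning

kernel-absorption : ∀ P z k →
  kernel P z (suc k) * frac 1 (suc k) ≡ sumFrom1 z (λ w → frac 1 w * kernel P w (suc k))
kernel-absorption P z k = begin
  frac (z C suc k) c * frac 1 (suc k)                      ≡⟨ frac-*-swap (z C suc k) c 1 (suc k) ⟩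
  frac 1 c * frac (z C suc k) (suc k)                      ≡⟨ cong (frac 1 c *_) (sumFrom1-wC[k+1]/w≡zC[k+1]/[k+1] z k) ⟨
  frac 1 c * sumFrom1 z (λ w → frac (w C suc k) w)         ≡⟨ *-distribˡ-sumFrom1 z (frac 1 c) _ ⟩
  sumFrom1 z (λ w → frac 1 c * frac (w C suc k) w)
    ≡⟨ sumFrom1-ext z (λ w → trans (frac-*-swap 1 c (w C suc k) w) (ℚ.*-comm (frac (w C suc k) c) (frac 1 w))) ⟩
  sumFrom1 z (λ w → frac 1 w * frac (w C suc k) c)         ∎
  where
  open ≡-Reasoning
  c = (P C suc k) ℕ.* suc P

tailDenominator : ℕ → ℕ → ℕ
tailDenominator D x = ((D ℕ.+ x) C D) ℕ.* suc (D ℕ.+ x)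

tailDenominator≢0 : ∀ D x → NonZero (tailDenominator D x)
tailDenominator≢0 D x = ℕ.m*n≢0 ((D ℕ.+ x) C D) (suc (D ℕ.+ x)) {{nCk≢0 (ℕ.m≤m+n D x)}}

tailDenominator-suc : ∀ D x →
  tailDenominator D (suc x) ℕ.* suc x ≡ tailDenominator D x ℕ.* suc (suc (D ℕ.+ x))
tailDenominator-suc D x rewrite ℕ.+-suc D x = begin
  (suc (D ℕ.+ x) C D) ℕ.* suc (suc (D ℕ.+ x)) ℕ.* suc x
    ≡⟨ solve 3 (λ a b c → a :* b :* c := a :* c :* b) refl
             (suc (D ℕ.+ x) C D) (suc (suc (D ℕ.+ x))) (suc x) ⟩
  (suc (D ℕ.+ x) C D) ℕ.* suc x ℕ.* suc (suc (D ℕ.+ x))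
    ≡⟨ cong (ℕ._* suc (suc (D ℕ.+ x))) ([k+v+1]Ck*[v+1]≡[k+v+1]*[k+v]Ck D x) ⟩
  suc (D ℕ.+ x) ℕ.* ((D ℕ.+ x) C D) ℕ.* suc (suc (D ℕ.+ x))
    ≡⟨ cong (ℕ._* suc (suc (D ℕ.+ x))) (ℕ.*-comm (suc (D ℕ.+ x)) ((D ℕ.+ x) C D)) ⟩
  tailDenominator D x ℕ.* suc (suc (D ℕ.+ x)) ∎
  where
  open ≡-Reasoning
  open ℕ-Solver

-- Closed form of Σ_{k = j+1}^{x} kernel (D + x) x k (`kernel-tailSum`).
kernelTail : ℕ → ℕ → ℕ → ℚ
kernelTail D x j = frac ((D ℕ.+ x ∸ j) C suc D) (tailDenominator D x)

kernelTail-vanishes : ∀ D x → kernelTail D x x ≡ 0ℚ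
kernelTail-vanishes D x =
  trans (cong (λ n → frac n (tailDenominator D x))
              (trans (cong (_C suc D) (ℕ.m+n∸n≡m D x)) (k>n⇒nCk≡0 (ℕ.n<1+n D))))
        (frac-0 (tailDenominator D x))

D+[j+w]∸j≡D+w : ∀ D j w → D ℕ.+ (j ℕ.+ w) ∸ j ≡ D ℕ.+ w
D+[j+w]∸j≡D+w D j w = trans (ℕ.+-∸-assoc D (ℕ.m≤m+n j w)) (cong (D ℕ.+_) (ℕ.m+n∸m≡n j w))

kernel-tail-step : ∀ D j w → let x = suc j ℕ.+ w in
  kernel (D ℕ.+ x) x (suc j) + kernelTail D x (suc j) ≡ kernelTail D x j
kernel-tail-step D j w = begin
  kernel P x (suc j) + kernelTail D x (suc j)
    ≡⟨ cong₂ _+_ kernel≡ (cong (λ n → frac (n C suc D) Z) (D+[j+w]∸j≡D+w D (suc j) w)) ⟩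
  frac ((D ℕ.+ w) C D) Z + frac ((D ℕ.+ w) C suc D) Z
    ≡⟨ frac-+ ((D ℕ.+ w) C D) ((D ℕ.+ w) C suc D) Z ⟩
  frac ((D ℕ.+ w) C D ℕ.+ (D ℕ.+ w) C suc D) Z
    ≡⟨ cong (λ n → frac n Z) (nCk+nC[k+1]≡[n+1]C[k+1] (D ℕ.+ w) D) ⟩
  frac (suc (D ℕ.+ w) C suc D) Z
    ≡⟨ cong (λ n → frac (n C suc D) Z) (trans (D+[j+w]∸j≡D+w D j (suc w)) (ℕ.+-suc D w)) ⟨
  frac ((D ℕ.+ (j ℕ.+ suc w) ∸ j) C suc D) Z
    ≡⟨ cong (λ n → frac ((D ℕ.+ n ∸ j) C suc D) Z) (ℕ.+-suc j w) ⟩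
  kernelTail D x j ∎
  where
  open ≡-Reasoning
  x = suc j ℕ.+ w
  P = D ℕ.+ x
  Z = tailDenominator D x
  instance
    _ = tailDenominator≢0 D x
    _ = kernelDenominator≢0 {P} {suc j} (ℕ.≤-trans (ℕ.m≤m+n (suc j) w) (ℕ.m≤n+m x D))
  kernel≡ : kernel P x (suc j) ≡ frac ((D ℕ.+ w) C D) Z
  kernel≡ = frac-cross (x C suc j) ((P C suc j) ℕ.* suc P) ((D ℕ.+ w) C D) Z (begin
    (x C suc j) ℕ.* ((P C D) ℕ.* suc P)   ≡⟨ ℕ.*-assoc (x C suc j) (P C D) (suc P) ⟨
    (x C suc j) ℕ.* (P C D) ℕ.* suc P     ≡⟨ cong (ℕ._* suc P) (trinomial-revision D (suc j) w) ⟩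
    ((D ℕ.+ w) C D) ℕ.* (P C suc j) ℕ.* suc P ≡⟨ ℕ.*-assoc ((D ℕ.+ w) C D) (P C suc j) (suc P) ⟩
    ((D ℕ.+ w) C D) ℕ.* ((P C suc j) ℕ.* suc P) ∎)

kernel-partialSum : ∀ D {x} j → j ≤ x →
  sumFrom1 j (kernel (D ℕ.+ x) x) + kernelTail D x j ≡ kernelTail D x 0
kernel-partialSum D zero _ = ℚ.+-identityˡ _
kernel-partialSum D (suc j) j<x with ℕ.m≤n⇒∃[o]m+o≡n j<x
... | w , refl = begin
  sumFrom1 j (kernel P x) + kernel P x (suc j) + kernelTail D x (suc j)
    ≡⟨ ℚ.+-assoc (sumFrom1 j (kernel P x)) (kernel P x (suc j)) (kernelTail D x (suc j)) ⟩
  sumFrom1 j (kernel P x) + (kernel P x (suc j) + kernelTail D x (suc j))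
    ≡⟨ cong (sumFrom1 j (kernel P x) +_) (kernel-tail-step D j w) ⟩
  sumFrom1 j (kernel P x) + kernelTail D x j
    ≡⟨ kernel-partialSum D j (ℕ.≤-trans (ℕ.n≤1+n j) j<x) ⟩
  kernelTail D x 0 ∎
  where
  open ≡-Reasoning
  x = suc j ℕ.+ w
  P = D ℕ.+ x

kernel-tailSum : ∀ D {x} j → j ≤ x →
  sumFrom1 x (kernel (D ℕ.+ x) x) - sumFrom1 j (kernel (D ℕ.+ x) x) ≡ kernelTail D x j
kernel-tailSum D {x} j j≤x = begin
  Σx - Σj                                 ≡⟨ cong (_- Σj) Σx≡T₀ ⟩
  kernelTail D x 0 - Σj                   ≡⟨ cong (_- Σj) (kernel-partialSum D j j≤x) ⟨
  (Σj + kernelTail D x j) - Σj            ≡⟨ solve 2 (λ a b → (a :+ b) :- a := b) refl Σj (kernelTail D x j) ⟩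
  kernelTail D x j ∎
  where
  open ≡-Reasoning
  open ℚ-Solver
  Σx = sumFrom1 x (kernel (D ℕ.+ x) x)
  Σj = sumFrom1 j (kernel (D ℕ.+ x) x)
  Σx≡T₀ : Σx ≡ kernelTail D x 0
  Σx≡T₀ = trans (sym (trans (cong (Σx +_) (kernelTail-vanishes D x)) (ℚ.+-identityʳ Σx)))
                (kernel-partialSum D x ℕ.≤-refl)

kernelTail-closed : ∀ D m u {x} → m ℕ.+ u ≡ x →
  kernelTail D x m * frac 1 (suc m) ≡ frac ((D ℕ.+ u) C suc D) (tailDenominator D x ℕ.* suc m)
kernelTail-closed D m u refl =
  trans (frac-* _ (tailDenominator D (m ℕ.+ u)) 1 (suc m))
        (cong (λ n → frac n (tailDenominator D (m ℕ.+ u) ℕ.* suc m))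
              (trans (ℕ.*-identityʳ _) (cong (_C suc D) (D+[j+w]∸j≡D+w D m u))))

kernelTail-telescoping-step : ∀ D m u → let x = m ℕ.+ u; sx = suc x in
  frac ((D ℕ.+ suc u) C suc D) (tailDenominator D sx ℕ.* suc m) ≡
  frac ((D ℕ.+ u) C suc D) (tailDenominator D x ℕ.* suc m) + frac 1 sx * kernel (D ℕ.+ sx) sx (suc m)
kernelTail-telescoping-step D m u = begin
  frac β′ (Zs ℕ.* m₁)
    ≡⟨ frac-cross β′ (Zs ℕ.* m₁) (sx ℕ.* β′) W
         (solve 4 (λ b Z s m → b :* (Z :* s :* m) := s :* b :* (Z :* m)) refl β′ Zs sx m₁) ⟩
  frac (sx ℕ.* β′) W
    ≡⟨ cong (λ n → frac n W) numerator ⟨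
  frac (β ℕ.* ss ℕ.+ m₁ ℕ.* α) W
    ≡⟨ frac-+ (β ℕ.* ss) (m₁ ℕ.* α) W ⟨
  frac (β ℕ.* ss) W + frac (m₁ ℕ.* α) W
    ≡⟨ cong₂ _+_ old new ⟨
  frac β (Z ℕ.* m₁) + frac 1 sx * kernel (D ℕ.+ sx) sx m₁ ∎
  where
  open ≡-Reasoning
  open ℕ-Solver
  x = m ℕ.+ u
  sx = suc x
  ss = suc (suc (D ℕ.+ x))
  m₁ = suc m
  α = (D ℕ.+ u) C D
  β = (D ℕ.+ u) C suc D
  β′ = (D ℕ.+ suc u) C suc D
  Z = tailDenominator D x
  Zs = tailDenominator D sx
  W = Zs ℕ.* sx ℕ.* m₁
  E = ((D ℕ.+ sx) C m₁) ℕ.* suc (D ℕ.+ sx)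
  instance
    _ = ℕ.m*n≢0 Z m₁ {{tailDenominator≢0 D x}}
    _ = ℕ.m*n≢0 Zs m₁ {{tailDenominator≢0 D sx}}
    _ = ℕ.m*n≢0 (Zs ℕ.* sx) m₁ {{ℕ.m*n≢0 Zs sx {{tailDenominator≢0 D sx}}}}
    _ = ℕ.m*n≢0 sx E {{_}} {{kernelDenominator≢0 (ℕ.≤-trans (s≤s (ℕ.m≤m+n m u)) (ℕ.m≤n+m sx D))}}
  numerator : β ℕ.* ss ℕ.+ m₁ ℕ.* α ≡ sx ℕ.* β′
  numerator = begin
    β ℕ.* ss ℕ.+ m₁ ℕ.* α
      ≡⟨ solve 5 (λ D m u α β → β :* (con 2 :+ (D :+ (m :+ u))) :+ (con 1 :+ m) :* α
                              := (con 1 :+ D) :* β :+ ((con 1 :+ (m :+ u)) :* β :+ (con 1 :+ m) :* α))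
               refl D m u α β ⟩
    suc D ℕ.* β ℕ.+ (sx ℕ.* β ℕ.+ m₁ ℕ.* α)
      ≡⟨ cong (ℕ._+ (sx ℕ.* β ℕ.+ m₁ ℕ.* α)) ([k+1]*[k+u]C[k+1]≡u*[k+u]Ck D u) ⟩
    u ℕ.* α ℕ.+ (sx ℕ.* β ℕ.+ m₁ ℕ.* α)
      ≡⟨ solve 4 (λ m u α β → u :* α :+ ((con 1 :+ (m :+ u)) :* β :+ (con 1 :+ m) :* α)
                              := (con 1 :+ (m :+ u)) :* (α :+ β)) refl m u α β ⟩
    sx ℕ.* (α ℕ.+ β)
      ≡⟨ cong (sx ℕ.*_) (nCk+nC[k+1]≡[n+1]C[k+1] (D ℕ.+ u) D) ⟩
    sx ℕ.* (suc (D ℕ.+ u) C suc D)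
      ≡⟨ cong (λ n → sx ℕ.* (n C suc D)) (ℕ.+-suc D u) ⟨
    sx ℕ.* β′ ∎
  old : frac β (Z ℕ.* m₁) ≡ frac (β ℕ.* ss) W
  old = frac-cross β (Z ℕ.* m₁) (β ℕ.* ss) W (begin
    β ℕ.* (Zs ℕ.* sx ℕ.* m₁)  ≡⟨ cong (λ t → β ℕ.* (t ℕ.* m₁)) (tailDenominator-suc D x) ⟩
    β ℕ.* (Z ℕ.* ss ℕ.* m₁)
      ≡⟨ solve 4 (λ b Z s m → b :* (Z :* s :* m) := b :* s :* (Z :* m)) refl β Z ss m₁ ⟩
    β ℕ.* ss ℕ.* (Z ℕ.* m₁)   ∎)
  new : frac 1 sx * kernel (D ℕ.+ sx) sx m₁ ≡ frac (m₁ ℕ.* α) W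
  new = trans (frac-* 1 sx (sx C m₁) E) (frac-cross (1 ℕ.* (sx C m₁)) (sx ℕ.* E) (m₁ ℕ.* α) W (begin
    1 ℕ.* (sx C m₁) ℕ.* W
      ≡⟨ solve 5 (λ c d e s m → con 1 :* c :* (d :* e :* s :* m) := c :* d :* (e :* s :* m)) refl
               (sx C m₁) ((D ℕ.+ sx) C D) (suc (D ℕ.+ sx)) sx m₁ ⟩
    (sx C m₁) ℕ.* ((D ℕ.+ sx) C D) ℕ.* (suc (D ℕ.+ sx) ℕ.* sx ℕ.* m₁)
      ≡⟨ cong (ℕ._* (suc (D ℕ.+ sx) ℕ.* sx ℕ.* m₁)) (trinomial-revision D m₁ u) ⟩
    α ℕ.* ((D ℕ.+ sx) C m₁) ℕ.* (suc (D ℕ.+ sx) ℕ.* sx ℕ.* m₁)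
      ≡⟨ solve 5 (λ a c e s m → a :* c :* (e :* s :* m) := m :* a :* (s :* (c :* e))) refl
               α ((D ℕ.+ sx) C m₁) (suc (D ℕ.+ sx)) sx m₁ ⟩
    m₁ ℕ.* α ℕ.* (sx ℕ.* E) ∎))

kernelTail-telescopes : ∀ D m u →
  kernelTail D (m ℕ.+ u) m * frac 1 (suc m) ≡ sumFrom1 (m ℕ.+ u) (λ y → frac 1 y * kernel (D ℕ.+ y) y (suc m))
kernelTail-telescopes D m zero rewrite ℕ.+-identityʳ m = begin
  kernelTail D m m * frac 1 (suc m) ≡⟨ cong (_* frac 1 (suc m)) (kernelTail-vanishes D m) ⟩
  0ℚ * frac 1 (suc m)               ≡⟨ ℚ.*-zeroˡ (frac 1 (suc m)) ⟩
  0ℚ                                ≡⟨ sumFrom1-zero m ⟨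
  sumFrom1 m (λ _ → 0ℚ)
    ≡⟨ sumFrom1-cong m (λ y _ y≤m →
         trans (cong (frac 1 y *_) (kernel-vanishes (D ℕ.+ y) (s≤s y≤m))) (ℚ.*-zeroʳ (frac 1 y))) ⟨
  sumFrom1 m (λ y → frac 1 y * kernel (D ℕ.+ y) y (suc m)) ∎
  where open ≡-Reasoning
kernelTail-telescopes D m (suc u) rewrite ℕ.+-suc m u = begin
  kernelTail D (suc x) m * frac 1 (suc m)
    ≡⟨ kernelTail-closed D m (suc u) (ℕ.+-suc m u) ⟩
  frac ((D ℕ.+ suc u) C suc D) (tailDenominator D (suc x) ℕ.* suc m)
    ≡⟨ kernelTail-telescoping-step D m u ⟩
  frac ((D ℕ.+ u) C suc D) (tailDenominator D x ℕ.* suc m) + newTerm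
    ≡⟨ cong (_+ newTerm) (kernelTail-closed D m u refl) ⟨
  kernelTail D x m * frac 1 (suc m) + newTerm
    ≡⟨ cong (_+ newTerm) (kernelTail-telescopes D m u) ⟩
  sumFrom1 (suc x) (λ y → frac 1 y * kernel (D ℕ.+ y) y (suc m)) ∎
  where
  open ≡-Reasoning
  x = m ℕ.+ u
  newTerm = frac 1 (suc x) * kernel (D ℕ.+ suc x) (suc x) (suc m)

kernel-interchange : ∀ z (P : ℕ → ℕ) (G : ℕ → ℚ) →
  sumFrom1 z (λ m → sumFrom1 z (λ w → frac 1 w * kernel (P w) w m) * G m) ≡
  sumFrom1 z (λ w → frac 1 w * sumFrom1 w (λ m → kernel (P w) w m * G m))
kernel-interchange z P G = begin
  sumFrom1 z (λ m → sumFrom1 z (λ w → frac 1 w * kernel (P w) w m) * G m)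
    ≡⟨ sumFrom1-ext z (λ m → *-distribʳ-sumFrom1 z (G m) (λ w → frac 1 w * kernel (P w) w m)) ⟩
  sumFrom1 z (λ m → sumFrom1 z (λ w → frac 1 w * kernel (P w) w m * G m))
    ≡⟨ sumFrom1-comm z z (λ m w → frac 1 w * kernel (P w) w m * G m) ⟩
  sumFrom1 z (λ w → sumFrom1 z (λ m → frac 1 w * kernel (P w) w m * G m))
    ≡⟨ sumFrom1-cong z (λ w _ w≤z → sumFrom1-vanishing z _ w≤z (λ m w<m _ → vanishes w m w<m)) ⟩
  sumFrom1 z (λ w → sumFrom1 w (λ m → frac 1 w * kernel (P w) w m * G m))
    ≡⟨ sumFrom1-ext z (λ w → trans (sumFrom1-ext w (λ m → ℚ.*-assoc (frac 1 w) (kernel (P w) w m) (G m)))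
                                   (sym (*-distribˡ-sumFrom1 w (frac 1 w) (λ m → kernel (P w) w m * G m)))) ⟩
  sumFrom1 z (λ w → frac 1 w * sumFrom1 w (λ m → kernel (P w) w m * G m)) ∎
  where
  open ≡-Reasoning
  vanishes : ∀ w m → w < m → frac 1 w * kernel (P w) w m * G m ≡ 0ℚ
  vanishes w m w<m = begin
    frac 1 w * kernel (P w) w m * G m ≡⟨ cong (λ t → frac 1 w * t * G m) (kernel-vanishes (P w) w<m) ⟩
    frac 1 w * 0ℚ * G m               ≡⟨ cong (_* G m) (ℚ.*-zeroʳ (frac 1 w)) ⟩
    0ℚ * G m                          ≡⟨ ℚ.*-zeroˡ (G m) ⟩
    0ℚ                                ∎

kernelSum-1/m : ∀ P z (G : ℕ → ℚ) →
  sumFrom1 z (λ m → kernel P z m * (frac 1 m * G m)) ≡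
  sumFrom1 z (λ w → frac 1 w * sumFrom1 w (λ m → kernel P w m * G m))
kernelSum-1/m P z G = begin
  sumFrom1 z (λ m → kernel P z m * (frac 1 m * G m))
    ≡⟨ sumFrom1-ext z (λ m → ℚ.*-assoc (kernel P z m) (frac 1 m) (G m)) ⟨
  sumFrom1 z (λ m → kernel P z m * frac 1 m * G m)
    ≡⟨ sumFrom1-cong z (λ { (suc k) _ _ → cong (_* G (suc k)) (kernel-absorption P z k) }) ⟩
  sumFrom1 z (λ m → sumFrom1 z (λ w → frac 1 w * kernel P w m) * G m)
    ≡⟨ kernel-interchange z (λ _ → P) G ⟩
  sumFrom1 z (λ w → frac 1 w * sumFrom1 w (λ m → kernel P w m * G m)) ∎
  where open ≡-Reasoning

kernelSum-nested-1/m : ∀ D x (G : ℕ → ℚ) →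
  sumFrom1 x (λ k → kernel (D ℕ.+ x) x k * sumFrom1 k (λ m → frac 1 m * G m)) ≡
  sumFrom1 x (λ y → frac 1 y * sumFrom1 y (λ m → kernel (D ℕ.+ y) y m * G m))
kernelSum-nested-1/m D x G = begin
  sumFrom1 x (λ k → K k * sumFrom1 k g)
    ≡⟨ sumFrom1-ext x (λ k → *-distribˡ-sumFrom1 k (K k) g) ⟩
  sumFrom1 x (λ k → sumFrom1 k (λ m → K k * g m))
    ≡⟨ sumFrom1-triangle x (λ k m → K k * g m) ⟩
  sumFrom1 x (λ m → sumFrom1 x (λ k → K k * g m) - sumFrom1 (ℕ.pred m) (λ k → K k * g m))
    ≡⟨ sumFrom1-cong x (λ { (suc m) _ m<x → tail≡ m (ℕ.≤-trans (ℕ.n≤1+n m) m<x) }) ⟩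
  sumFrom1 x (λ m → sumFrom1 x (λ y → frac 1 y * kernel (D ℕ.+ y) y m) * G m)
    ≡⟨ kernel-interchange x (D ℕ.+_) G ⟩
  sumFrom1 x (λ y → frac 1 y * sumFrom1 y (λ m → kernel (D ℕ.+ y) y m * G m)) ∎
  where
  open ≡-Reasoning
  K : ℕ → ℚ
  K = kernel (D ℕ.+ x) x
  g : ℕ → ℚ
  g m = frac 1 m * G m
  tail≡ : ∀ m → m ≤ x →
    sumFrom1 x (λ k → K k * g (suc m)) - sumFrom1 m (λ k → K k * g (suc m)) ≡
    sumFrom1 x (λ y → frac 1 y * kernel (D ℕ.+ y) y (suc m)) * G (suc m)
  tail≡ m m≤x with ℕ.m≤n⇒∃[o]m+o≡n m≤x
  ... | u , refl = begin
    sumFrom1 x (λ k → K k * g (suc m)) - sumFrom1 m (λ k → K k * g (suc m))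
      ≡⟨ cong₂ _-_ (*-distribʳ-sumFrom1 x (g (suc m)) K) (*-distribʳ-sumFrom1 m (g (suc m)) K) ⟨
    sumFrom1 x K * g (suc m) - sumFrom1 m K * g (suc m)
      ≡⟨ solve 4 (λ a b c d → a :* (c :* d) :- b :* (c :* d) := (a :- b) :* c :* d) refl
               (sumFrom1 x K) (sumFrom1 m K) (frac 1 (suc m)) (G (suc m)) ⟩
    (sumFrom1 x K - sumFrom1 m K) * frac 1 (suc m) * G (suc m)
      ≡⟨ cong (λ t → t * frac 1 (suc m) * G (suc m)) (kernel-tailSum D m m≤x) ⟩
    kernelTail D x m * frac 1 (suc m) * G (suc m)
      ≡⟨ cong (_* G (suc m)) (kernelTail-telescopes D m u) ⟩
    sumFrom1 x (λ y → frac 1 y * kernel (D ℕ.+ y) y (suc m)) * G (suc m) ∎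
    where open ℚ-Solver

1/w*chainSum : ∀ t w (F : List ℕ → ℚ) →
  frac 1 w * chainSum t w (λ ms → frac 1 (product ms) * F ms) ≡
  chainSum t w (λ ms → frac 1 (product (w ∷ ms)) * F ms)
1/w*chainSum t w F = begin
  frac 1 w * chainSum t w (λ ms → frac 1 (product ms) * F ms)
    ≡⟨ *-distribˡ-chainSum t w (frac 1 w) _ ⟩
  chainSum t w (λ ms → frac 1 w * (frac 1 (product ms) * F ms))
    ≡⟨ chainSum-cong t w (λ ms _ → trans (sym (ℚ.*-assoc (frac 1 w) (frac 1 (product ms)) (F ms)))
                                         (cong (_* F ms) (sym (frac-1-distrib-* w (product ms))))) ⟩
  chainSum t w (λ ms → frac 1 (w ℕ.* product ms) * F ms) ∎
  where open ≡-Reasoning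

1/m^[1+t] : ∀ m t (g : ℕ → ℚ) → frac 1 (m ℕ.^ suc t) * g m ≡ frac 1 m * (frac 1 (m ℕ.^ t) * g m)
1/m^[1+t] m t g = trans (cong (_* g m) (frac-1-distrib-* m (m ℕ.^ t))) (ℚ.*-assoc (frac 1 m) (frac 1 (m ℕ.^ t)) (g m))

kernelSum-powers : ∀ t P z (g : ℕ → ℚ) →
  sumFrom1 z (λ m → kernel P z m * (frac 1 (m ℕ.^ t) * g m)) ≡
  chainSum t z (λ ms → frac 1 (product ms) * sumFrom1 (lastOr z ms) (λ k → kernel P (lastOr z ms) k * g k))
kernelSum-powers zero P z g =
  trans (sumFrom1-ext z (λ m → cong (kernel P z m *_) (ℚ.*-identityˡ (g m))))
        (sym (ℚ.*-identityˡ _))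
kernelSum-powers (suc t) P z g = begin
  sumFrom1 z (λ m → kernel P z m * (frac 1 (m ℕ.^ suc t) * g m))
    ≡⟨ sumFrom1-ext z (λ m → cong (kernel P z m *_) (1/m^[1+t] m t g)) ⟩
  sumFrom1 z (λ m → kernel P z m * (frac 1 m * (frac 1 (m ℕ.^ t) * g m)))
    ≡⟨ kernelSum-1/m P z (λ m → frac 1 (m ℕ.^ t) * g m) ⟩
  sumFrom1 z (λ w → frac 1 w * sumFrom1 w (λ m → kernel P w m * (frac 1 (m ℕ.^ t) * g m)))
    ≡⟨ sumFrom1-ext z (λ w → cong (frac 1 w *_) (kernelSum-powers t P w g)) ⟩
  sumFrom1 z (λ w → frac 1 w * chainSum t w (λ ms → frac 1 (product ms) * tailSum (lastOr w ms)))
    ≡⟨ sumFrom1-ext z (λ w → 1/w*chainSum t w (λ ms → tailSum (lastOr w ms))) ⟩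
  chainSum (suc t) z (λ ms → frac 1 (product ms) * tailSum (lastOr z ms)) ∎
  where
  open ≡-Reasoning
  tailSum : ℕ → ℚ
  tailSum l = sumFrom1 l (λ k → kernel P l k * g k)

kernelSum-block : ∀ t D x (V : ℕ → ℚ) →
  sumFrom1 x (λ k → kernel (D ℕ.+ x) x k * sumFrom1 k (λ m → frac 1 (m ℕ.^ suc t) * V m)) ≡
  sumFrom1 x (λ y → chainSum t y (λ ys →
    frac 1 (product (y ∷ ys)) * sumFrom1 (lastOr y ys) (λ k → kernel (D ℕ.+ y) (lastOr y ys) k * V k)))
kernelSum-block t D x V = begin
  sumFrom1 x (λ k → kernel (D ℕ.+ x) x k * sumFrom1 k (λ m → frac 1 (m ℕ.^ suc t) * V m))
    ≡⟨ sumFrom1-ext x (λ k → cong (kernel (D ℕ.+ x) x k *_) (sumFrom1-ext k (λ m → 1/m^[1+t] m t V))) ⟩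
  sumFrom1 x (λ k → kernel (D ℕ.+ x) x k * sumFrom1 k (λ m → frac 1 m * G m))
    ≡⟨ kernelSum-nested-1/m D x G ⟩
  sumFrom1 x (λ y → frac 1 y * sumFrom1 y (λ m → kernel (D ℕ.+ y) y m * G m))
    ≡⟨ sumFrom1-ext x (λ y → cong (frac 1 y *_) (kernelSum-powers t (D ℕ.+ y) y V)) ⟩
  sumFrom1 x (λ y → frac 1 y * chainSum t y (λ ys → frac 1 (product ys) * tailSum y (lastOr y ys)))
    ≡⟨ sumFrom1-ext x (λ y → 1/w*chainSum t y (λ ys → tailSum y (lastOr y ys))) ⟩
  sumFrom1 x (λ y → chainSum t y (λ ys → frac 1 (product (y ∷ ys)) * tailSum y (lastOr y ys))) ∎
  where
  open ≡-Reasoning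
  G : ℕ → ℚ
  G m = frac 1 (m ℕ.^ t) * V m
  tailSum : ℕ → ℕ → ℚ
  tailSum y l = sumFrom1 l (λ k → kernel (D ℕ.+ y) l k * V k)

idx-++ : ∀ pre rest j → idx (pre ++ rest) (length pre ℕ.+ suc j) ≡ idx rest (suc j)
idx-++ []           rest j = refl
idx-++ (m ∷ [])     rest j = refl
idx-++ (m ∷ m′ ∷ ms) rest j = idx-++ (m′ ∷ ms) rest j

idx-lastOr : ∀ y ys rest → idx ((y ∷ ys) ++ rest) (length (y ∷ ys)) ≡ lastOr y ys
idx-lastOr y []       rest = refl
idx-lastOr y (m ∷ ms) rest = idx-lastOr m ms rest

prodFirst-++ : ∀ pre rest j → prodFirst (length pre ℕ.+ j) (pre ++ rest) ≡ product pre ℕ.* prodFirst j rest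
prodFirst-++ []       rest j = sym (ℕ.+-identityʳ (prodFirst j rest))
prodFirst-++ (m ∷ ms) rest j =
  trans (cong (m ℕ.*_) (prodFirst-++ ms rest j)) (sym (ℕ.*-assoc m (product ms) (prodFirst j rest)))

mutual
  -- `Qs` sums with a local function that Defs does not export. `Qs-go` is that function:
  -- the meta is solved by unification in `Qs-unfold`, where `with suc d` turns the
  -- implicit length into a variable so that the unification problem is a pattern.
  Qs-go : ∀ {d} → Vec ℕ d → List ℕ → ℕ → ℕ
  Qs-go = _

  Qs-unfold : ∀ {d} (s : Vec ℕ (suc d)) ns →
    Qs s ns ≡ Qs-go s ns d ℕ.+ (idx ns (suc (partialWt s d)) ∸ idx ns (partialWt s (suc d)))
  Qs-unfold {d} s ns with suc d
  ... | _ = refl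

Qs-go-++ : ∀ e {d} (s : Vec ℕ d) y ys rest r →
  Qs-go (length (y ∷ ys) ∷ suc e ∷ s) ((y ∷ ys) ++ rest) (suc r) ≡
  (y ∸ lastOr y ys) ℕ.+ Qs-go (suc e ∷ s) rest r
Qs-go-++ e s y ys rest zero =
  trans (cong (y ∸_) (trans (cong (idx ns) (ℕ.+-identityʳ (length (y ∷ ys)))) (idx-lastOr y ys rest)))
        (sym (ℕ.+-identityʳ (y ∸ lastOr y ys)))
  where ns = (y ∷ ys) ++ rest
Qs-go-++ e s y ys rest (suc r) = begin
  Qs-go s₀ ns (suc r) ℕ.+ (idx ns (suc (len ℕ.+ w r)) ∸ idx ns (len ℕ.+ suc (e ℕ.+ partialWt s r)))
    ≡⟨ cong₂ (λ a b → a ℕ.+ (b ∸ idx ns (len ℕ.+ suc (e ℕ.+ partialWt s r))))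
             (Qs-go-++ e s y ys rest r)
             (trans (cong (idx ns) (sym (ℕ.+-suc len (w r)))) (idx-++ (y ∷ ys) rest (w r))) ⟩
  (y ∸ lastOr y ys) ℕ.+ Qs-go s′ rest r ℕ.+ (idx rest (suc (w r)) ∸ idx ns (len ℕ.+ suc (e ℕ.+ partialWt s r)))
    ≡⟨ cong (λ b → (y ∸ lastOr y ys) ℕ.+ Qs-go s′ rest r ℕ.+ (idx rest (suc (w r)) ∸ b))
            (idx-++ (y ∷ ys) rest (e ℕ.+ partialWt s r)) ⟩
  (y ∸ lastOr y ys) ℕ.+ Qs-go s′ rest r ℕ.+ (idx rest (suc (w r)) ∸ idx rest (suc (e ℕ.+ partialWt s r)))
    ≡⟨ ℕ.+-assoc (y ∸ lastOr y ys) (Qs-go s′ rest r) _ ⟩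
  (y ∸ lastOr y ys) ℕ.+ Qs-go s′ rest (suc r) ∎
  where
  open ≡-Reasoning
  len = length (y ∷ ys)
  s′ = suc e ∷ s
  s₀ = len ∷ s′
  ns = (y ∷ ys) ++ rest
  w = partialWt s′

Qs-++ : ∀ e {d} (s : Vec ℕ d) y ys rest →
  Qs (length (y ∷ ys) ∷ suc e ∷ s) ((y ∷ ys) ++ rest) ≡ (y ∸ lastOr y ys) ℕ.+ Qs (suc e ∷ s) rest
Qs-++ e {d} s y ys rest = Qs-go-++ e s y ys rest (suc d)

Qs-single : ∀ y ys rest → Qs (length (y ∷ ys) ∷ []) ((y ∷ ys) ++ rest) ≡ y ∸ lastOr y ys
Qs-single y ys rest = trans (Qs-unfold (length (y ∷ ys) ∷ []) ns)
  (cong (y ∸_) (trans (cong (idx ns) (ℕ.+-identityʳ (length (y ∷ ys)))) (idx-lastOr y ys rest)))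
  where ns = (y ∷ ys) ++ rest

rhsSummand : ℚ → ℕ → ℕ → ℕ → ℕ → ℚ
rhsSummand a Q n k π = frac (n C k) ((Q ℕ.+ n) C k) * ((a ^q k) * frac 1 ((Q ℕ.+ n ℕ.+ 1) ℕ.* π))

rhsSummand-cong : ∀ a {Q Q′ n n′ k k′ π π′} → Q ≡ Q′ → n ≡ n′ → k ≡ k′ → π ≡ π′ →
                  rhsSummand a Q n k π ≡ rhsSummand a Q′ n′ k′ π′
rhsSummand-cong a refl refl refl refl = refl

rhsSummand-* : ∀ a Q n k p π → rhsSummand a Q n k (p ℕ.* π) ≡ frac 1 p * rhsSummand a Q n k π
rhsSummand-* a Q n k p π = begin
  frac (n C k) ((Q ℕ.+ n) C k) * ((a ^q k) * frac 1 (E ℕ.* (p ℕ.* π)))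
    ≡⟨ cong (λ t → frac (n C k) ((Q ℕ.+ n) C k) * ((a ^q k) * frac 1 t)) (x∙yz≈y∙xz E p π) ⟩
  frac (n C k) ((Q ℕ.+ n) C k) * ((a ^q k) * frac 1 (p ℕ.* (E ℕ.* π)))
    ≡⟨ cong (λ t → frac (n C k) ((Q ℕ.+ n) C k) * ((a ^q k) * t)) (frac-1-distrib-* p (E ℕ.* π)) ⟩
  frac (n C k) ((Q ℕ.+ n) C k) * ((a ^q k) * (frac 1 p * frac 1 (E ℕ.* π)))
    ≡⟨ solve 4 (λ c x f y → c :* (x :* (f :* y)) := f :* (c :* (x :* y))) refl
             (frac (n C k) ((Q ℕ.+ n) C k)) (a ^q k) (frac 1 p) (frac 1 (E ℕ.* π)) ⟩
  frac 1 p * rhsSummand a Q n k π ∎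
  where
  open ≡-Reasoning
  open ℚ-Solver
  E = Q ℕ.+ n ℕ.+ 1

rhsSummand-kernel : ∀ a Q n k → rhsSummand a Q n k 1 ≡ kernel (Q ℕ.+ n) n k * (a ^q k)
rhsSummand-kernel a Q n k = begin
  frac (n C k) ((Q ℕ.+ n) C k) * ((a ^q k) * frac 1 ((Q ℕ.+ n ℕ.+ 1) ℕ.* 1))
    ≡⟨ cong (λ t → frac (n C k) ((Q ℕ.+ n) C k) * ((a ^q k) * frac 1 t))
            (trans (ℕ.*-identityʳ (Q ℕ.+ n ℕ.+ 1)) (ℕ.+-comm (Q ℕ.+ n) 1)) ⟩
  frac (n C k) ((Q ℕ.+ n) C k) * ((a ^q k) * frac 1 (suc (Q ℕ.+ n)))
    ≡⟨ solve 3 (λ c x f → c :* (x :* f) := c :* f :* x) refl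
             (frac (n C k) ((Q ℕ.+ n) C k)) (a ^q k) (frac 1 (suc (Q ℕ.+ n))) ⟩
  frac (n C k) ((Q ℕ.+ n) C k) * frac 1 (suc (Q ℕ.+ n)) * (a ^q k)
    ≡⟨ cong (_* (a ^q k)) (frac-* (n C k) ((Q ℕ.+ n) C k) 1 (suc (Q ℕ.+ n))) ⟩
  frac ((n C k) ℕ.* 1) (((Q ℕ.+ n) C k) ℕ.* suc (Q ℕ.+ n)) * (a ^q k)
    ≡⟨ cong (λ t → frac t (((Q ℕ.+ n) C k) ℕ.* suc (Q ℕ.+ n)) * (a ^q k)) (ℕ.*-identityʳ (n C k)) ⟩
  kernel (Q ℕ.+ n) n k * (a ^q k) ∎
  where
  open ≡-Reasoning
  open ℚ-Solver

-- `rhsTerm6` with Q(s) replaced by D + Q(s); at D = 0 it is `rhsTerm6` itself.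
shiftedTerm : ∀ {d} → Vec ℕ d → ℚ → ℕ → List ℕ → ℚ
shiftedTerm s a D ns = rhsSummand a (D ℕ.+ Qs s ns) (idx ns (wt s)) (idx ns (suc (wt s))) (prodFirst (wt s) ns)

shiftedTerm-++ : ∀ a D e {d} (s : Vec ℕ d) y ys rest →
  shiftedTerm (length (y ∷ ys) ∷ suc e ∷ s) a D ((y ∷ ys) ++ rest) ≡
  frac 1 (product (y ∷ ys)) * shiftedTerm (suc e ∷ s) a (D ℕ.+ (y ∸ lastOr y ys)) rest
shiftedTerm-++ a D e s y ys rest = trans
  (rhsSummand-cong a
    (trans (cong (D ℕ.+_) (Qs-++ e s y ys rest)) (sym (ℕ.+-assoc D (y ∸ lastOr y ys) (Qs (suc e ∷ s) rest))))
    (idx-++ (y ∷ ys) rest (e ℕ.+ wt s))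
    (trans (cong (idx ns) (sym (ℕ.+-suc len w))) (idx-++ (y ∷ ys) rest w))
    (prodFirst-++ (y ∷ ys) rest w))
  (rhsSummand-* a (D ℕ.+ (y ∸ lastOr y ys) ℕ.+ Qs (suc e ∷ s) rest) (idx rest w) (idx rest (suc w))
                 (product (y ∷ ys)) (prodFirst w rest))
  where
  len = length (y ∷ ys)
  w = wt (suc e ∷ s)
  ns = (y ∷ ys) ++ rest

shiftedTerm-last : ∀ a D y ys k → let l = lastOr y ys in
  shiftedTerm (length (y ∷ ys) ∷ []) a D ((y ∷ ys) ++ k ∷ []) ≡
  frac 1 (product (y ∷ ys)) * (kernel (D ℕ.+ (y ∸ l) ℕ.+ l) l k * (a ^q k))
shiftedTerm-last a D y ys k = trans
  (rhsSummand-cong a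
    (cong (D ℕ.+_) (Qs-single y ys (k ∷ [])))
    (trans (cong (idx ns) (ℕ.+-identityʳ len)) (idx-lastOr y ys (k ∷ [])))
    (trans (cong (idx ns) (sym (ℕ.+-suc len 0))) (idx-++ (y ∷ ys) (k ∷ []) 0))
    (prodFirst-++ (y ∷ ys) (k ∷ []) 0))
  (trans (rhsSummand-* a (D ℕ.+ (y ∸ lastOr y ys)) (lastOr y ys) k (product (y ∷ ys)) 1)
         (cong (frac 1 (product (y ∷ ys)) *_) (rhsSummand-kernel a (D ℕ.+ (y ∸ lastOr y ys)) (lastOr y ys) k)))
  where
  len = length (y ∷ ys)
  ns = (y ∷ ys) ++ k ∷ []

-- ζ*_k(s; a) as an iterated sum; at s = [] the empty chain's last index is k itself.
nestedZeta : ∀ {d} → Vec ℕ d → ℚ → ℕ → ℚ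
nestedZeta []      a k = a ^q k
nestedZeta (e ∷ s) a k = sumFrom1 k (λ m → frac 1 (m ℕ.^ e) * nestedZeta s a m)

chainSum-peel : ∀ {d} e (s : Vec ℕ d) a m →
  chainSum d m (λ ms → (a ^q lastL (m ∷ ms)) * frac 1 (prodPow (e ∷ s) (m ∷ ms))) ≡
  frac 1 (m ℕ.^ e) * chainSum d m (λ ms → (a ^q lastL (m ∷ ms)) * frac 1 (prodPow s ms))
chainSum-peel {d} e s a m = begin
  chainSum d m (λ ms → A ms * frac 1 (m ℕ.^ e ℕ.* prodPow s ms))
    ≡⟨ chainSum-cong d m (λ ms _ → trans (cong (A ms *_) (frac-1-distrib-* (m ℕ.^ e) (prodPow s ms)))
         (solve 3 (λ x y z → x :* (y :* z) := y :* (x :* z)) refl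
                (A ms) (frac 1 (m ℕ.^ e)) (frac 1 (prodPow s ms)))) ⟩
  chainSum d m (λ ms → frac 1 (m ℕ.^ e) * (A ms * frac 1 (prodPow s ms)))
    ≡⟨ *-distribˡ-chainSum d m (frac 1 (m ℕ.^ e)) _ ⟨
  frac 1 (m ℕ.^ e) * chainSum d m (λ ms → A ms * frac 1 (prodPow s ms)) ∎
  where
  open ≡-Reasoning
  open ℚ-Solver
  A : List ℕ → ℚ
  A ms = a ^q lastL (m ∷ ms)

chainSum-nestedZeta : ∀ {d} (s : Vec ℕ d) a m →
  chainSum d m (λ ms → (a ^q lastL (m ∷ ms)) * frac 1 (prodPow s ms)) ≡ nestedZeta s a m
chainSum-nestedZeta []      a m = ℚ.*-identityʳ (a ^q m)
chainSum-nestedZeta (e ∷ s) a m = sumFrom1-ext m (λ m′ →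
  trans (chainSum-peel e s a m′) (cong (frac 1 (m′ ℕ.^ e) *_) (chainSum-nestedZeta s a m′)))

zetaStar≡nestedZeta : ∀ {d} (s : Vec ℕ (suc d)) a k → zetaStar k s a ≡ nestedZeta s a k
zetaStar≡nestedZeta s a k = chainSum-nestedZeta s a k

D+[y∸l]+l≡D+y : ∀ D {y l} → l ≤ y → D ℕ.+ (y ∸ l) ℕ.+ l ≡ D ℕ.+ y
D+[y∸l]+l≡D+y D l≤y = trans (ℕ.+-assoc D _ _) (cong (D ℕ.+_) (ℕ.m∸n+n≡m l≤y))

mutual
  kernelSum-nestedZeta : ∀ {d} (s : Vec ℕ (suc d)) → (∀ i → 1 ≤ lookup s i) → ∀ a D x →
    sumFrom1 x (λ k → kernel (D ℕ.+ x) x k * nestedZeta s a k) ≡ chainSum (suc (wt s)) x (shiftedTerm s a D)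
  kernelSum-nestedZeta (zero ∷ s) pos a D x with pos Fin.zero
  ... | ()
  kernelSum-nestedZeta (suc t ∷ s) pos a D x = begin
    sumFrom1 x (λ k → kernel (D ℕ.+ x) x k * nestedZeta (suc t ∷ s) a k)
      ≡⟨ kernelSum-block t D x (nestedZeta s a) ⟩
    sumFrom1 x (λ y → chainSum t y (λ ys →
      frac 1 (product (y ∷ ys)) * sumFrom1 (lastOr y ys) (λ k → kernel (D ℕ.+ y) (lastOr y ys) k * nestedZeta s a k)))
      ≡⟨ sumFrom1-ext x (λ y → chainSum-cong t y (λ ys c → tail≡ y ys (Chain-length c) (Chain-lastOr≤ c))) ⟩
    sumFrom1 x (λ y → chainSum t y (λ ys →
      chainSum (suc (wt s)) (lastOr y ys) (λ rest → shiftedTerm (suc t ∷ s) a D ((y ∷ ys) ++ rest))))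
      ≡⟨ chainSum-++ (suc t) (suc (wt s)) x (shiftedTerm (suc t ∷ s) a D) ⟨
    chainSum (suc t ℕ.+ suc (wt s)) x (shiftedTerm (suc t ∷ s) a D)
      ≡⟨ cong (λ L → chainSum L x (shiftedTerm (suc t ∷ s) a D)) (ℕ.+-suc (suc t) (wt s)) ⟩
    chainSum (suc (wt (suc t ∷ s))) x (shiftedTerm (suc t ∷ s) a D) ∎
    where
    open ≡-Reasoning
    tail≡ : ∀ y ys → length ys ≡ t → lastOr y ys ≤ y → let l = lastOr y ys in
      frac 1 (product (y ∷ ys)) * sumFrom1 l (λ k → kernel (D ℕ.+ y) l k * nestedZeta s a k) ≡
      chainSum (suc (wt s)) l (λ rest → shiftedTerm (suc t ∷ s) a D ((y ∷ ys) ++ rest))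
    tail≡ y ys len≡t l≤y =
      trans (cong (frac 1 (product (y ∷ ys)) *_)
                  (sumFrom1-ext (lastOr y ys) (λ k → cong (λ P → kernel P (lastOr y ys) k * nestedZeta s a k)
                                                         (sym (D+[y∸l]+l≡D+y D l≤y)))))
            (blockTail s (λ i → pos (Fin.suc i)) a D y ys len≡t)

  blockTail : ∀ {d} (s : Vec ℕ d) → (∀ i → 1 ≤ lookup s i) → ∀ a D y ys {t} → length ys ≡ t →
    let l = lastOr y ys in
    frac 1 (product (y ∷ ys)) * sumFrom1 l (λ k → kernel (D ℕ.+ (y ∸ l) ℕ.+ l) l k * nestedZeta s a k) ≡
    chainSum (suc (wt s)) l (λ rest → shiftedTerm (suc t ∷ s) a D ((y ∷ ys) ++ rest))
  blockTail [] _ a D y ys refl =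
    trans (*-distribˡ-sumFrom1 (lastOr y ys) (frac 1 (product (y ∷ ys))) _)
          (sumFrom1-ext (lastOr y ys) (λ k → sym (shiftedTerm-last a D y ys k)))
  blockTail (zero ∷ s) pos a D y ys _ with pos Fin.zero
  ... | ()
  blockTail (suc e ∷ s) pos a D y ys refl = begin
    frac 1 p * sumFrom1 l (λ k → kernel (D′ ℕ.+ l) l k * nestedZeta (suc e ∷ s) a k)
      ≡⟨ cong (frac 1 p *_) (kernelSum-nestedZeta (suc e ∷ s) pos a D′ l) ⟩
    frac 1 p * chainSum (suc (wt (suc e ∷ s))) l (shiftedTerm (suc e ∷ s) a D′)
      ≡⟨ *-distribˡ-chainSum (suc (wt (suc e ∷ s))) l (frac 1 p) (shiftedTerm (suc e ∷ s) a D′) ⟩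
    chainSum (suc (wt (suc e ∷ s))) l (λ rest → frac 1 p * shiftedTerm (suc e ∷ s) a D′ rest)
      ≡⟨ chainSum-cong (suc (wt (suc e ∷ s))) l (λ rest _ → sym (shiftedTerm-++ a D e s y ys rest)) ⟩
    chainSum (suc (wt (suc e ∷ s))) l
      (λ rest → shiftedTerm (length (y ∷ ys) ∷ suc e ∷ s) a D ((y ∷ ys) ++ rest)) ∎
    where
    open ≡-Reasoning
    p = product (y ∷ ys)
    l = lastOr y ys
    D′ = D ℕ.+ (y ∸ l)

theorem6 : (a : ℚ) (d n : ℕ) (s : Vec ℕ d) → 1 ≤ d → (∀ i → 1 ≤ lookup s i) →
    lhs6 n s a ≡ rhs6 n s a
theorem6 a (suc d) n s _ pos = begin
  frac 1 (suc n) * sumFrom1 n (λ k → zetaStar k s a)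
    ≡⟨ *-distribˡ-sumFrom1 n (frac 1 (suc n)) (λ k → zetaStar k s a) ⟩
  sumFrom1 n (λ k → frac 1 (suc n) * zetaStar k s a)
    ≡⟨ sumFrom1-cong n (λ k _ k≤n → cong₂ _*_ (sym (kernel-diagonal k≤n)) (zetaStar≡nestedZeta s a k)) ⟩
  sumFrom1 n (λ k → kernel n n k * nestedZeta s a k)
    ≡⟨ kernelSum-nestedZeta s pos a 0 n ⟩
  rhs6 n s a ∎
  where open ≡-Reasoning
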